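{- For every $r\in\mathbb{N}$ and every finite graph $H$, if $\mathcal{G}$ is a class of graphs closed under taking induced subgraphs such that no graph in $\mathcal{G}$ contains $H$ as an $r$-fat minor, then no graph in $\mathcal{G}$ contains $H^{(3r)}$ as an induced minor.
   Context: $H^{(s)}$ denotes the $s$-subdivision of $H$: the graph obtained from $H$ by replacing each edge $uv$ by a $(u,v)$-path with exactly $s$ internal vertices. $H$ is an induced minor of $G$ if it can be obtained from an induced subgraph of $G$ by contracting edges. For $r\in\mathbb{N}$, an $r$-fat minor model of $H$ in $G$ is a collection $(B_v\colon v\in V(H))\cup(P_e\colon e\in E(H))$ of connected subgraphs of $G$ such that (F1) $V(B_v)\cap V(P_e)\ne\emptyset$ whenever $v$ is an endpoint of $e$, and (F2) any two distinct members $X,Y$ of the collection not forming such a pair $(B_v,P_e)$ satisfy $\mathrm{dist}_G(X,Y)\ge r$ (shortest-path distance in $G$). $H$ is an $r$-fat minor of $G$ if $G$ contains an $r$-fat minor model of $H$. -}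

module Defs where

open import Data.Nat using (ℕ; zero; suc; _≤_; _<_)
open import Data.Nat.Properties using (1+n≢n)
open import Data.Fin using (Fin; toℕ)
open import Data.Bool using (Bool; true; false)
open import Data.Product using (Σ; ∃; ∃-syntax; _×_; _,_; proj₁; proj₂)
open import Data.Sum using (_⊎_; inj₁; inj₂)
open import Data.Empty using (⊥)
open import Data.Unit using (⊤)
open import Relation.Nullary using (¬_)
open import Relation.Binary.PropositionalEquality
  using (_≡_; _≢_; refl; sym; trans; subst)

record Graph : Set₁ where
  field
    V      : Set
    E      : V → V → Set
    E-sym  : ∀ {u v} → E u v → E v u
    E-irr  : ∀ {u} → ¬ E u u
open Graph public

VSet : Graph → Set₁
VSet G = V G → Set

data WalkIn (G : Graph) (X : VSet G) : V G → V G → ℕ → Set where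
  stay : ∀ {u} → X u → WalkIn G X u u zero
  step : ∀ {u w v n} → X u → E G u w → WalkIn G X w v n → WalkIn G X u v (suc n)

All : (G : Graph) → VSet G
All G _ = ⊤

Walk : (G : Graph) → V G → V G → ℕ → Set
Walk G = WalkIn G (All G)

Connected : (G : Graph) → VSet G → Set
Connected G X = (∃[ x ] X x) × (∀ x y → X x → X y → ∃[ n ] WalkIn G X x y n)

-- dist_G(X, Y) ≥ r : every walk in G from X to Y has length ≥ r
-- (vacuous if there is no such walk, i.e. distance ∞).
DistGE : (G : Graph) → VSet G → VSet G → ℕ → Set
DistGE G X Y r = ∀ x y n → X x → Y y → Walk G x y n → r ≤ n

Disjoint : (G : Graph) → VSet G → VSet G → Set
Disjoint G X Y = ∀ x → X x → Y x → ⊥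

Touch : (G : Graph) → VSet G → VSet G → Set
Touch G X Y = ∃[ x ] ∃[ y ] (X x × Y y × E G x y)

Induced : (G : Graph) → VSet G → Graph
Induced G P = record
  { V     = Σ (V G) P
  ; E     = λ a b → E G (proj₁ a) (proj₁ b)
  ; E-sym = E-sym G
  ; E-irr = E-irr G
  }

InducedClosed : (Graph → Set) → Set₁
InducedClosed 𝒢 = ∀ G → 𝒢 G → (P : VSet G) → 𝒢 (Induced G P)

record FinGraph : Set where
  field
    n       : ℕ
    adj     : Fin n → Fin n → Bool
    adj-sym : ∀ i j → adj i j ≡ adj j i
    adj-irr : ∀ i → adj i i ≡ false
open FinGraph public

Edge : FinGraph → Set
Edge H = Σ (Fin (n H)) λ i → Σ (Fin (n H)) λ j → (toℕ i < toℕ j) × (adj H i j ≡ true)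

low high : ∀ {H} → Edge H → Fin (n H)
low  (i , _) = i
high (_ , j , _) = j

true≢false : true ≡ false → ⊥
true≢false ()

toGraph : FinGraph → Graph
toGraph H = record
  { V     = Fin (n H)
  ; E     = λ i j → adj H i j ≡ true
  ; E-sym = λ {i} {j} e → trans (adj-sym H j i) e
  ; E-irr = λ {i} e → true≢false (trans (sym e) (adj-irr H i))
  }

-- s-subdivision H^(s): edge e = ij (i<j) is replaced by the path
-- i - (e,0) - (e,1) - ... - (e,s-1) - j   (or the edge ij itself if s = 0).

SubV : FinGraph → ℕ → Set
SubV H s = Fin (n H) ⊎ (Edge H × Fin s)

EndAdj : ∀ H s → Fin (n H) → Edge H → Fin s → Set
EndAdj H s a e k = (a ≡ low {H} e × toℕ k ≡ 0) ⊎ (a ≡ high {H} e × suc (toℕ k) ≡ s)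

SubE : ∀ H s → SubV H s → SubV H s → Set
SubE H s (inj₁ a) (inj₁ b) = (s ≡ 0) × (adj H a b ≡ true)
SubE H s (inj₁ a) (inj₂ (e , k)) = EndAdj H s a e k
SubE H s (inj₂ (e , k)) (inj₁ a) = EndAdj H s a e k
SubE H s (inj₂ (e , k)) (inj₂ (f , l)) =
  (e ≡ f) × ((suc (toℕ k) ≡ toℕ l) ⊎ (suc (toℕ l) ≡ toℕ k))

private
  SubE-sym : ∀ H s {u v} → SubE H s u v → SubE H s v u
  SubE-sym H s {inj₁ a} {inj₁ b} (z , e) = z , trans (adj-sym H b a) e
  SubE-sym H s {inj₁ a} {inj₂ _} p = p
  SubE-sym H s {inj₂ _} {inj₁ a} p = p
  SubE-sym H s {inj₂ _} {inj₂ _} (refl , inj₁ q) = refl , inj₂ q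
  SubE-sym H s {inj₂ _} {inj₂ _} (refl , inj₂ q) = refl , inj₁ q

  SubE-irr : ∀ H s {u} → ¬ SubE H s u u
  SubE-irr H s {inj₁ a} (_ , e) = true≢false (trans (sym e) (adj-irr H a))
  SubE-irr H s {inj₂ (e , k)} (_ , inj₁ q) = 1+n≢n q
  SubE-irr H s {inj₂ (e , k)} (_ , inj₂ q) = 1+n≢n q

Subdivision : FinGraph → ℕ → Graph
Subdivision H s = record
  { V     = SubV H s
  ; E     = SubE H s
  ; E-sym = SubE-sym H s
  ; E-irr = SubE-irr H s
  }

-- Induced minors: H is an induced minor of G iff there are pairwise
-- disjoint connected vertex sets X_v (v ∈ V(H)) such that, for v ≠ w,
-- some edge of G joins X_v and X_w exactly when vw ∈ E(H).
-- (Standard equivalent of "obtained from an induced subgraph by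
-- contracting edges".)

record InducedMinorModel (H G : Graph) : Set₁ where
  field
    X        : V H → VSet G
    conn     : ∀ v → Connected G (X v)
    disj     : ∀ v w → v ≢ w → Disjoint G (X v) (X w)
    touch⇒E  : ∀ v w → v ≢ w → Touch G (X v) (X w) → E H v w
    E⇒touch  : ∀ v w → E H v w → Touch G (X v) (X w)

IsInducedMinor : Graph → Graph → Set₁
IsInducedMinor H G = InducedMinorModel H G

-- Members of the collection are indexed by V(H) ⊎ E(H); a connected
-- subgraph is represented by its (connected-inducing) vertex set, which is
-- all that (F1) and (F2) depend on.

Member : FinGraph → Set
Member H = Fin (n H) ⊎ Edge H

Incident : ∀ H → Member H → Member H → Set
Incident H (inj₁ v) (inj₂ e) = (v ≡ low {H} e) ⊎ (v ≡ high {H} e)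
Incident H (inj₂ e) (inj₁ v) = (v ≡ low {H} e) ⊎ (v ≡ high {H} e)
Incident H _ _ = ⊥

record FatMinorModel (r : ℕ) (H : FinGraph) (G : Graph) : Set₁ where
  field
    M     : Member H → VSet G          -- B_v = M (inj₁ v), P_e = M (inj₂ e)
    conn  : ∀ m → Connected G (M m)
    F1    : ∀ v e → Incident H (inj₁ v) (inj₂ e) →
              ∃[ x ] (M (inj₁ v) x × M (inj₂ e) x)
    F2    : ∀ m m' → m ≢ m' → ¬ Incident H m m' → DistGE G (M m) (M m') r

IsFatMinor : ℕ → FinGraph → Graph → Set₁
IsFatMinor r H G = FatMinorModel r H G

{-# OPTIONS --safe #-}
module Submission where

-- Let s = 3r, and number the vertices of each subdivided edge e of H^(s) by the positions
-- 0, …, s + 1. On every e, the branch set of the lower end of e takes the positions [0, r],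
-- that of the upper end takes [2r + 1, s + 1], and P_e takes [r, 2r + 1]. Incident members share
-- a position. Any other two members are at least r apart, because the distance to a member,
-- capped at r, is 1-Lipschitz. So H is an r-fat minor of H^(3r).
-- Now let H^(3r) be an induced minor of G, and let G' be the subgraph induced on the union of
-- the branch sets. Replacing every vertex by its branch set carries this model to G'. Distances
-- cannot shrink, because a walk in G' contracts to a walk in H^(3r) that is no longer: the model
-- is induced. Since G' ∈ 𝒢, this contradicts the hypothesis.

open import Defs
open import Data.Nat using (ℕ; zero; suc; _+_; _*_; _∸_; _≤_; _<_; z≤n; s≤s; s≤s⁻¹; z<s; _⊓_; _⊔_; _≤?_; _<?_; _≤‴_; ≤‴-refl; ≤‴-step)
open import Data.Nat.Properties
open import Data.Fin using (Fin; toℕ; fromℕ<)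
import Data.Fin.Properties as Fin
open import Data.Bool using (true)
import Data.Bool.Properties as Bool
open import Data.Maybe using (Maybe; just; nothing)
open import Data.Product using (∃-syntax; ∃₂; _×_; _,_; proj₁; proj₂)
import Data.Product.Properties as Product
open import Data.Sum using (_⊎_; inj₁; inj₂)
import Data.Sum.Properties as Sum
open import Data.Unit using (tt)
open import Data.Empty using (⊥-elim)
open import Effect.Monad using (RawMonad)
open import Function using (_∘_)
open import Relation.Nullary using (¬_; Dec; yes; no)
open import Relation.Nullary.Decidable using (decidable-stable; ¬¬-excluded-middle)
open import Relation.Nullary.Negation using (¬¬-Monad; ¬¬-map)
open import Relation.Binary.Definitions using (DecidableEquality)
open import Relation.Binary.PropositionalEquality using (_≡_; _≢_; refl; sym; trans; cong; cong₂; subst; module ≡-Reasoning)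
open import Axiom.UniquenessOfIdentityProofs using (module Decidable⇒UIP)

Reachable : (G : Graph) → VSet G → V G → V G → Set
Reachable G X u v = ∃[ n ] WalkIn G X u v n

Component : (G : Graph) → VSet G → V G → VSet G
Component G X h w = X w × Reachable G X h w

module _ {G : Graph} {X : VSet G} where

  walk-start : ∀ {u v n} → WalkIn G X u v n → X u
  walk-start (stay x) = x
  walk-start (step x _ _) = x

  walk-end : ∀ {u v n} → WalkIn G X u v n → X v
  walk-end (stay x) = x
  walk-end (step _ _ W) = walk-end W

  reachable-refl : ∀ {u} → X u → Reachable G X u u
  reachable-refl x = 0 , stay x

  reachable-step : ∀ {u v w} → X u → E G u v → Reachable G X v w → Reachable G X u w
  reachable-step x e (n , W) = suc n , step x e W

  reachable-trans : ∀ {u v w} → Reachable G X u v → Reachable G X v w → Reachable G X u w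
  reachable-trans (_ , stay _) R = R
  reachable-trans (_ , step x e W) R = reachable-step x e (reachable-trans (_ , W) R)

  reachable-sym : ∀ {u v} → Reachable G X u v → Reachable G X v u
  reachable-sym (_ , stay x) = reachable-refl x
  reachable-sym (_ , step x e W) =
    reachable-trans (reachable-sym (_ , W)) (reachable-step (walk-start W) (E-sym G e) (reachable-refl x))

  path-reachable : (f : ℕ → V G) {i j : ℕ} → i ≤‴ j →
                   (∀ q → i ≤ q → q < j → E G (f q) (f (suc q))) →
                   (∀ q → i ≤ q → q ≤ j → X (f q)) →
                   Reachable G X (f i) (f j)
  path-reachable f ≤‴-refl _ onPath = reachable-refl (onPath _ ≤-refl ≤-refl)
  path-reachable f {i} (≤‴-step i<j) adjacent onPath =
    reachable-step (onPath i ≤-refl (<⇒≤ i<j′)) (adjacent i ≤-refl i<j′)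
      (path-reachable f i<j (λ q i<q → adjacent q (<⇒≤ i<q)) (λ q i<q → onPath q (<⇒≤ i<q)))
    where i<j′ = ≤‴⇒≤ i<j

module _ {G : Graph} {X : VSet G} where

  walk-in-component : ∀ {h u w n} → Reachable G X h u → WalkIn G X u w n → WalkIn G (Component G X h) u w n
  walk-in-component R (stay x) = stay (x , R)
  walk-in-component R (step x e W) =
    step (x , R) e (walk-in-component (reachable-trans R (reachable-step x e (reachable-refl (walk-start W)))) W)

  component-connected : ∀ {h} → X h → Connected G (Component G X h)
  component-connected {h} x = (h , x , reachable-refl x) , walks
    where
    from-hub : ∀ {w} → Reachable G X h w → Reachable G (Component G X h) h w
    from-hub (n , W) = n , walk-in-component (reachable-refl x) W

    walks : ∀ u w → Component G X h u → Component G X h w → Reachable G (Component G X h) u w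
    walks u w (_ , Ru) (_ , Rw) = reachable-trans (reachable-sym (from-hub Ru)) (from-hub Rw)

Lipschitz : (G : Graph) → (V G → ℕ) → Set
Lipschitz G f = ∀ {a b} → E G a b → f b ≤ suc (f a)

module _ {G : Graph} {f : V G → ℕ} (f-lip : Lipschitz G f) where

  walk-lipschitz : ∀ {X u w n} → WalkIn G X u w n → f w ≤ n + f u
  walk-lipschitz (stay _) = ≤-refl
  walk-lipschitz {n = suc n} (step _ e W) =
    ≤-trans (walk-lipschitz W) (≤-trans (+-monoʳ-≤ n (f-lip e)) (≤-reflexive (+-suc n _)))

  lipschitz⇒distGE : ∀ {X Y r} → (∀ x → X x → f x ≡ 0) → (∀ y → Y y → r ≤ f y) → DistGE G X Y r
  lipschitz⇒distGE {r = r} zero-on-X far-on-Y x y n x∈X y∈Y W = begin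
    r          ≤⟨ far-on-Y y y∈Y ⟩
    f y        ≤⟨ walk-lipschitz W ⟩
    n + f x    ≡⟨ cong (n +_) (zero-on-X x x∈X) ⟩
    n + 0      ≡⟨ +-identityʳ n ⟩
    n          ∎
    where open ≤-Reasoning

module Lifting {K G : Graph} (μ : InducedMinorModel K G) where
  open InducedMinorModel μ renaming (conn to branch-conn)

  Covered : VSet G
  Covered x = ∃[ a ] X a x

  CoveredGraph : Graph
  CoveredGraph = Induced G Covered

  branch : V CoveredGraph → V K
  branch (_ , a , _) = a

  lift : VSet K → VSet CoveredGraph
  lift S w = S (branch w)

  base-proof : ∀ a → X a (proj₁ (proj₁ (branch-conn a)))
  base-proof a = proj₂ (proj₁ (branch-conn a))

  base : V K → V CoveredGraph
  base a = _ , a , base-proof a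

  module _ {S : VSet K} where

    enter-branch : ∀ {u b y z n} → lift S u → S b → E G (proj₁ u) y → WalkIn G (X b) y z n → (q : X b z) →
            Reachable CoveredGraph (lift S) u (z , b , q)
    enter-branch su sb e (stay _) q = reachable-step su e (reachable-refl sb)
    enter-branch su sb e (step p e′ W) q = reachable-step su e (enter-branch {u = _ , _ , p} sb sb e′ W q)

    within-branch : ∀ {a x x′ n} → S a → (p : X a x) → WalkIn G (X a) x x′ n →
             ∃[ q ] Reachable CoveredGraph (lift S) (x , a , p) (x′ , a , q)
    within-branch sa p (stay _) = p , reachable-refl sa
    within-branch sa p (step _ e W) = walk-end W , enter-branch sa sa e W (walk-end W)

    cross-edge : ∀ {a b} → S a → S b → E K a b → Reachable CoveredGraph (lift S) (base a) (base b)
    cross-edge {a} {b} sa sb e with E⇒touch a b e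
    ... | x′ , y′ , px′ , py′ , exy =
      let (q , into-x′) = within-branch sa (base-proof a) (proj₂ (proj₂ (branch-conn a) _ x′ (base-proof a) px′))
      in reachable-trans into-x′
           (enter-branch {u = x′ , a , q} sa sb exy (proj₂ (proj₂ (branch-conn b) y′ _ py′ (base-proof b))) (base-proof b))

    lift-reachable : ∀ {a b} → Reachable K S a b → Reachable CoveredGraph (lift S) (base a) (base b)
    lift-reachable (_ , stay sa) = reachable-refl sa
    lift-reachable (_ , step sa e W) = reachable-trans (cross-edge sa (walk-start W) e) (lift-reachable (_ , W))

  -- Whether an edge of CoveredGraph stays inside one branch set need not be decidable. The
  -- conclusion r ≤ n of lift-distGE is decidable, so it is enough to contract walks under ¬ ¬.
  contract : ∀ {u w n} → Walk CoveredGraph u w n → ¬ ¬ (∃[ m ] m ≤ n × Walk K (branch u) (branch w) m)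
  contract (stay _) = pure (0 , z≤n , stay tt)
    where open RawMonad ¬¬-Monad
  contract (step {u} {v} _ e W) = do
      shortened ← contract W
      same-branch? ← ¬¬-excluded-middle
      pure (extend u v e same-branch? shortened)
    where
    open RawMonad ¬¬-Monad
    extend : ∀ {c n} u v → E G (proj₁ u) (proj₁ v) → Dec (branch u ≡ branch v) →
             ∃[ m ] m ≤ n × Walk K (branch v) c m → ∃[ m ] m ≤ suc n × Walk K (branch u) c m
    extend _ _ _ (yes refl) (m , m≤n , W′) = m , m≤n⇒m≤1+n m≤n , W′
    extend (x , a , p) (y , b , q) e (no a≢b) (m , m≤n , W′) =
      suc m , s≤s m≤n , step tt (touch⇒E a b a≢b (x , y , p , q , e)) W′

  lift-distGE : ∀ {S T r} → DistGE K S T r → DistGE CoveredGraph (lift S) (lift T) r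
  lift-distGE {r = r} far u w n su tw W = decidable-stable (r ≤? n) (¬¬-map bound (contract W))
    where
    bound : ∃[ m ] m ≤ n × Walk K (branch u) (branch w) m → r ≤ n
    bound (m , m≤n , W′) = ≤-trans (far _ _ m su tw W′) m≤n

  -- A point of G lies in CoveredGraph once for each proof that it belongs to its branch set.
  -- So lifted members are taken to be components of base points: the lift of a connected
  -- set need not be connected.
  lift-fat : ∀ {r H} → FatMinorModel r H K → FatMinorModel r H CoveredGraph
  lift-fat {H = H} φ = record
    { M = M′
    ; conn = λ m → component-connected (hub∈ m)
    ; F1 = λ v e inc → let (a , a∈Bv , a∈Pe) = F1 v e inc
                       in base a , (a∈Bv , reach (inj₁ v) a∈Bv) , (a∈Pe , reach (inj₂ e) a∈Pe)
    ; F2 = λ m m′ m≢m′ ¬inc u w n u∈ w∈ →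
             lift-distGE (F2 m m′ m≢m′ ¬inc) u w n (proj₁ u∈) (proj₁ w∈)
    }
    where
    open FatMinorModel φ renaming (conn to member-conn)

    hub : Member H → V K
    hub m = proj₁ (proj₁ (member-conn m))

    hub∈ : ∀ m → M m (hub m)
    hub∈ m = proj₂ (proj₁ (member-conn m))

    M′ : Member H → VSet CoveredGraph
    M′ m = Component CoveredGraph (lift (M m)) (base (hub m))

    reach : ∀ m {a} → M m a → Reachable CoveredGraph (lift (M m)) (base (hub m)) (base a)
    reach m a∈ = lift-reachable (proj₂ (member-conn m) _ _ (hub∈ m) a∈)

infix 4 _≈₁_

_≈₁_ : ℕ → ℕ → Set
m ≈₁ n = m ≤ suc n × n ≤ suc m

∸-≈₁ˡ : ∀ c q → c ∸ q ≈₁ c ∸ suc q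
∸-≈₁ˡ c q = down c q , m≤n⇒m≤1+n (∸-monoʳ-≤ c (n≤1+n q))
  where
  down : ∀ c q → c ∸ q ≤ suc (c ∸ suc q)
  down zero q = ≤-trans (≤-reflexive (0∸n≡0 q)) z≤n
  down (suc c) zero = ≤-refl
  down (suc c) (suc q) = down c q

∸-≈₁ʳ : ∀ c q → q ∸ c ≈₁ suc q ∸ c
∸-≈₁ʳ c q = m≤n⇒m≤1+n (∸-monoˡ-≤ c (n≤1+n q)) , up c q
  where
  up : ∀ c q → suc q ∸ c ≤ suc (q ∸ c)
  up zero q = ≤-refl
  up (suc c) zero = ≤-trans (≤-reflexive (0∸n≡0 c)) z≤n
  up (suc c) (suc q) = up c q

⊔-≈₁ : ∀ {a b c d} → a ≈₁ b → c ≈₁ d → a ⊔ c ≈₁ b ⊔ d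
⊔-≈₁ (a≤ , b≤) (c≤ , d≤) = ⊔-mono-≤ a≤ c≤ , ⊔-mono-≤ b≤ d≤

⊓-≈₁ : ∀ {a b} c → a ≈₁ b → a ⊓ c ≈₁ b ⊓ c
⊓-≈₁ c (a≤ , b≤) = ⊓-mono-≤ a≤ (n≤1+n c) , ⊓-mono-≤ b≤ (n≤1+n c)

gap : ℕ × ℕ → ℕ → ℕ
gap (lo , hi) q = (lo ∸ q) ⊔ (q ∸ hi)

_∈[_] : ℕ → ℕ × ℕ → Set
q ∈[ lo , hi ] = lo ≤ q × q ≤ hi

gap-≈₁ : ∀ I q → gap I q ≈₁ gap I (suc q)
gap-≈₁ (lo , hi) q = ⊔-≈₁ (∸-≈₁ˡ lo q) (∸-≈₁ʳ hi q)

gap-inside : ∀ I q → q ∈[ I ] → gap I q ≡ 0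
gap-inside _ _ (lo≤q , q≤hi) rewrite m≤n⇒m∸n≡0 lo≤q | m≤n⇒m∸n≡0 q≤hi = refl

gap-zero : ∀ I q → gap I q ≡ 0 → q ∈[ I ]
gap-zero (lo , hi) q gap≡0 =
  m∸n≡0⇒m≤n (n≤0⇒n≡0 (≤-trans (m≤m⊔n (lo ∸ q) _) (≤-reflexive gap≡0))) ,
  m∸n≡0⇒m≤n (n≤0⇒n≡0 (≤-trans (m≤n⊔m _ (q ∸ hi)) (≤-reflexive gap≡0)))

gap-above : ∀ I q {d} → proj₂ I + d ≤ q → d ≤ gap I q
gap-above (lo , hi) q {d} hi+d≤q = begin
  d                ≡⟨ sym (m+n∸m≡n hi d) ⟩
  hi + d ∸ hi      ≤⟨ ∸-monoˡ-≤ hi hi+d≤q ⟩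
  q ∸ hi           ≤⟨ m≤n⊔m (lo ∸ q) _ ⟩
  gap (lo , hi) q  ∎
  where open ≤-Reasoning

gap-below : ∀ I q {d} → q + d ≤ proj₁ I → d ≤ gap I q
gap-below (lo , hi) q {d} q+d≤lo = begin
  d                ≡⟨ sym (m+n∸m≡n q d) ⟩
  q + d ∸ q        ≤⟨ ∸-monoˡ-≤ q q+d≤lo ⟩
  lo ∸ q           ≤⟨ m≤m⊔n _ (q ∸ hi) ⟩
  gap (lo , hi) q  ∎
  where open ≤-Reasoning

module _ {H : FinGraph} where

  edge-≟ : DecidableEquality (Edge H)
  edge-≟ = Product.≡-dec Fin._≟_ (Product.≡-dec Fin._≟_ proofs-≟)
    where
    proofs-≟ : ∀ {i j} → DecidableEquality (toℕ i < toℕ j × adj H i j ≡ true)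
    proofs-≟ (p , q) (p′ , q′) = yes (cong₂ _,_ (<-irrelevant p p′) (Decidable⇒UIP.≡-irrelevant Bool._≟_ q q′))

  member-≟ : DecidableEquality (Member H)
  member-≟ = Sum.≡-dec Fin._≟_ edge-≟

  low<high : (e : Edge H) → toℕ (low {H} e) < toℕ (high {H} e)
  low<high (_ , _ , lt , _) = lt

module FatInSubdivision (H : FinGraph) (t : ℕ) where

  r : ℕ
  r = suc t

  s : ℕ
  s = 3 * r

  Sub : Graph
  Sub = Subdivision H s

  s≡r+r+r : s ≡ r + r + r
  s≡r+r+r = trans (cong (r +_) (cong (r +_) (+-identityʳ r))) (sym (+-assoc r r r))

  r+r≤s : r + r ≤ s
  r+r≤s = ≤-trans (m≤m+n (r + r) r) (≤-reflexive (sym s≡r+r+r))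

  -- Position 0 is low e, position k + 1 is the internal vertex (e , k), and position s + 1 is high e.
  along : Edge H → ℕ → SubV H s
  along e zero = inj₁ (low {H} e)
  along e (suc q) with q <? s
  ... | yes q<s = inj₂ (e , fromℕ< q<s)
  ... | no _ = inj₁ (high {H} e)

  along-internal : ∀ e (k : Fin s) → inj₂ (e , k) ≡ along e (suc (toℕ k))
  along-internal e k with toℕ k <? s
  ... | yes k<s = cong (λ k → inj₂ (e , k)) (sym (Fin.fromℕ<-toℕ k k<s))
  ... | no k≮s = ⊥-elim (k≮s (Fin.toℕ<n k))

  along-high : ∀ e → along e (suc s) ≡ inj₁ (high {H} e)
  along-high e with s <? s
  ... | yes s<s = ⊥-elim (<-irrefl refl s<s)
  ... | no _ = refl

  along-adjacent : ∀ e q → q ≤ s → SubE H s (along e q) (along e (suc q))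
  along-adjacent e zero _ with 0 <? s
  ... | yes 0<s = inj₁ (refl , Fin.toℕ-fromℕ< 0<s)
  ... | no 0≮s = ⊥-elim (0≮s z<s)
  along-adjacent e (suc q) q<s with q <? s | suc q <? s
  ... | no q≮s | _ = ⊥-elim (q≮s q<s)
  ... | yes _ | yes sq<s = refl , inj₁ (trans (cong suc (Fin.toℕ-fromℕ< q<s)) (sym (Fin.toℕ-fromℕ< sq<s)))
  ... | yes _ | no sq≮s = inj₂ (refl , trans (cong suc (Fin.toℕ-fromℕ< q<s)) (≤∧≮⇒≡ q<s sq≮s))

  edge-along : ∀ {a b} → SubE H s a b →
               ∃₂ λ e q → q ≤ s × (a ≡ along e q × b ≡ along e (suc q) ⊎ b ≡ along e q × a ≡ along e (suc q))
  edge-along {inj₁ _} {inj₁ _} (() , _)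
  edge-along {inj₁ _} {inj₂ (e , k)} (inj₁ (refl , k≡0)) =
    e , 0 , z≤n , inj₁ (refl , trans (along-internal e k) (cong (along e ∘ suc) k≡0))
  edge-along {inj₁ _} {inj₂ (e , k)} (inj₂ (refl , sk≡s)) =
    e , s , ≤-refl , inj₂ (trans (along-internal e k) (cong (along e) sk≡s) , sym (along-high e))
  edge-along {inj₂ (e , k)} {inj₁ _} (inj₁ (refl , k≡0)) =
    e , 0 , z≤n , inj₂ (refl , trans (along-internal e k) (cong (along e ∘ suc) k≡0))
  edge-along {inj₂ (e , k)} {inj₁ _} (inj₂ (refl , sk≡s)) =
    e , s , ≤-refl , inj₁ (trans (along-internal e k) (cong (along e) sk≡s) , sym (along-high e))
  edge-along {inj₂ (e , k)} {inj₂ (_ , l)} (refl , inj₁ sk≡l) =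
    e , suc (toℕ k) , Fin.toℕ<n k , inj₁ (along-internal e k , trans (along-internal e l) (cong (along e ∘ suc) (sym sk≡l)))
  edge-along {inj₂ (e , k)} {inj₂ (_ , l)} (refl , inj₂ sl≡k) =
    e , suc (toℕ l) , Fin.toℕ<n l , inj₂ (along-internal e l , trans (along-internal e k) (cong (along e ∘ suc) (sym sl≡k)))

  data Part : Set where
    low-end middle high-end : Part

  owner : Edge H → Part → Member H
  owner e low-end = inj₁ (low {H} e)
  owner e middle = inj₂ e
  owner e high-end = inj₁ (high {H} e)

  part : Member H → Edge H → Maybe Part
  part (inj₁ v) e with v Fin.≟ low {H} e | v Fin.≟ high {H} e
  ... | yes _ | _ = just low-end
  ... | no _ | yes _ = just high-end
  ... | no _ | no _ = nothing
  part (inj₂ f) e with edge-≟ {H} f e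
  ... | yes _ = just middle
  ... | no _ = nothing

  part-sound : ∀ m e {ρ} → part m e ≡ just ρ → m ≡ owner e ρ
  part-sound (inj₁ v) e eq with v Fin.≟ low {H} e | v Fin.≟ high {H} e | eq
  ... | yes refl | _ | refl = refl
  ... | no _ | yes refl | refl = refl
  ... | no _ | no _ | ()
  part-sound (inj₂ f) e eq with edge-≟ {H} f e | eq
  ... | yes refl | refl = refl
  ... | no _ | ()

  part-owner : ∀ e ρ → part (owner e ρ) e ≡ just ρ
  part-owner e low-end with low {H} e Fin.≟ low {H} e
  ... | yes _ = refl
  ... | no low≢low = ⊥-elim (low≢low refl)
  part-owner e middle with edge-≟ {H} e e
  ... | yes _ = refl
  ... | no e≢e = ⊥-elim (e≢e refl)
  part-owner e high-end with high {H} e Fin.≟ low {H} e | high {H} e Fin.≟ high {H} e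
  ... | yes high≡low | _ = ⊥-elim (<-irrefl (cong toℕ (sym high≡low)) (low<high {H} e))
  ... | no _ | yes _ = refl
  ... | no _ | no high≢high = ⊥-elim (high≢high refl)

  -- B_(low e) and B_(high e) are r + 1 apart. Each of them shares one position with P_e.
  interval : Part → ℕ × ℕ
  interval low-end = 0 , r
  interval middle = r , suc (r + r)
  interval high-end = suc (r + r) , suc s

  interval-bounded : ∀ ρ {q} → q ∈[ interval ρ ] → q ≤ suc s
  interval-bounded low-end (_ , q≤r) = ≤-trans q≤r (≤-trans (m≤m+n r r) (m≤n⇒m≤1+n r+r≤s))
  interval-bounded middle (_ , q≤hi) = ≤-trans q≤hi (s≤s r+r≤s)
  interval-bounded high-end (_ , q≤hi) = q≤hi

  -- Distance, capped at r, to the positions that a member occupies on a subdivided edge.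
  capped : Maybe Part → ℕ → ℕ
  capped nothing _ = r
  capped (just ρ) q = gap (interval ρ) q ⊓ r

  capped-≈₁ : ∀ J q → capped J q ≈₁ capped J (suc q)
  capped-≈₁ nothing q = n≤1+n r , n≤1+n r
  capped-≈₁ (just ρ) q = ⊓-≈₁ r (gap-≈₁ (interval ρ) q)

  capped-inside : ∀ ρ q → q ∈[ interval ρ ] → capped (just ρ) q ≡ 0
  capped-inside ρ q q∈ = cong (_⊓ r) (gap-inside (interval ρ) q q∈)

  capped-outside : ∀ ρ q → r ≤ gap (interval ρ) q → capped (just ρ) q ≡ r
  capped-outside _ _ = m≥n⇒m⊓n≡n

  capped-zero : ∀ J q → capped J q ≡ 0 → ∃[ ρ ] J ≡ just ρ × q ∈[ interval ρ ]
  capped-zero (just ρ) q capped≡0 = ρ , refl , gap-zero (interval ρ) q (⊓r≡0 (gap (interval ρ) q) capped≡0)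
    where
    ⊓r≡0 : ∀ g → g ⊓ r ≡ 0 → g ≡ 0
    ⊓r≡0 zero _ = refl

  pot : Member H → SubV H s → ℕ
  pot m (inj₁ u) with member-≟ {H} m (inj₁ u)
  ... | yes _ = 0
  ... | no _ = r
  pot m (inj₂ (e , k)) = capped (part m e) (suc (toℕ k))

  Core : Member H → VSet Sub
  Core m a = pot m a ≡ 0

  pot-at-end : ∀ m e ρ₀ q u → owner e ρ₀ ≡ inj₁ u → q ∈[ interval ρ₀ ] →
               (∀ ρ → ρ ≢ ρ₀ → r ≤ gap (interval ρ) q) → pot m (inj₁ u) ≡ capped (part m e) q
  pot-at-end m e ρ₀ q u owner≡u q∈ isolated with member-≟ {H} m (inj₁ u)
  ... | yes refl = sym (subst (λ m → capped (part m e) q ≡ 0) owner≡u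
                         (trans (cong (λ J → capped J q) (part-owner e ρ₀)) (capped-inside ρ₀ q q∈)))
  ... | no m≢u with part m e in part≡
  ...   | nothing = refl
  ...   | just ρ = sym (capped-outside ρ q (isolated ρ λ { refl → m≢u (trans (part-sound m e part≡) owner≡u) }))

  pot-along : ∀ m e q → q ≤ suc s → pot m (along e q) ≡ capped (part m e) q
  pot-along m e zero _ = pot-at-end m e low-end 0 _ refl (z≤n , z≤n) isolated
    where
    isolated : ∀ ρ → ρ ≢ low-end → r ≤ gap (interval ρ) 0
    isolated low-end ρ≢ρ = ⊥-elim (ρ≢ρ refl)
    isolated middle _ = gap-below (interval middle) 0 ≤-refl
    isolated high-end _ = gap-below (interval high-end) 0 (m≤n⇒m≤1+n (m≤m+n r r))
  pot-along m e (suc q) q≤s with q <? s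
  ... | yes q<s = cong (capped (part m e) ∘ suc) (Fin.toℕ-fromℕ< q<s)
  ... | no q≮s with ≤∧≮⇒≡ (s≤s⁻¹ q≤s) q≮s
  ...   | refl = pot-at-end m e high-end (suc s) _ refl (s≤s r+r≤s , ≤-refl) isolated
    where
    isolated : ∀ ρ → ρ ≢ high-end → r ≤ gap (interval ρ) (suc s)
    isolated low-end _ = gap-above (interval low-end) (suc s) (m≤n⇒m≤1+n r+r≤s)
    isolated middle _ = gap-above (interval middle) (suc s) (s≤s (≤-reflexive (sym s≡r+r+r)))
    isolated high-end ρ≢ρ = ⊥-elim (ρ≢ρ refl)

  pot-≈₁-along : ∀ m e q → q ≤ s → pot m (along e q) ≈₁ pot m (along e (suc q))
  pot-≈₁-along m e q q≤s rewrite pot-along m e q (m≤n⇒m≤1+n q≤s) | pot-along m e (suc q) (s≤s q≤s) =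
    capped-≈₁ (part m e) q

  pot-lipschitz : ∀ m → Lipschitz Sub (pot m)
  pot-lipschitz m ab with edge-along ab
  ... | e , q , q≤s , inj₁ (refl , refl) = proj₂ (pot-≈₁-along m e q q≤s)
  ... | e , q , q≤s , inj₂ (refl , refl) = proj₁ (pot-≈₁-along m e q q≤s)

  pot-far : ∀ m m′ → m ≢ m′ → ¬ Incident H m m′ → ∀ a → Core m′ a → r ≤ pot m a
  pot-far m m′ m≢m′ _ (inj₁ u) zero′ with member-≟ {H} m′ (inj₁ u) | member-≟ {H} m (inj₁ u)
  ... | yes refl | yes refl = ⊥-elim (m≢m′ refl)
  ... | yes refl | no _ = ≤-refl
  pot-far m m′ m≢m′ ¬inc (inj₂ (e , k)) zero′ with part m e in part≡
  ... | nothing = ≤-refl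
  ... | just ρ with capped-zero (part m′ e) _ zero′
  ...   | ρ′ , part′≡ , q∈ with part-sound m e part≡ | part-sound m′ e part′≡
  ...     | refl | refl = ≤-reflexive (sym (capped-outside ρ _ (apart ρ ρ′ m≢m′ ¬inc q∈)))
    where
    apart : ∀ ρ ρ′ {q} → owner e ρ ≢ owner e ρ′ → ¬ Incident H (owner e ρ) (owner e ρ′) →
            q ∈[ interval ρ′ ] → r ≤ gap (interval ρ) q
    apart low-end low-end ≢ _ _ = ⊥-elim (≢ refl)
    apart low-end middle _ ¬inc _ = ⊥-elim (¬inc (inj₁ refl))
    apart low-end high-end {q} _ _ (2r<q , _) = gap-above (interval low-end) q (≤-trans (n≤1+n _) 2r<q)
    apart middle low-end _ ¬inc _ = ⊥-elim (¬inc (inj₁ refl))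
    apart middle middle ≢ _ _ = ⊥-elim (≢ refl)
    apart middle high-end _ ¬inc _ = ⊥-elim (¬inc (inj₂ refl))
    apart high-end low-end {q} _ _ (_ , q≤r) = gap-below (interval high-end) q (m≤n⇒m≤1+n (+-monoˡ-≤ r q≤r))
    apart high-end middle _ ¬inc _ = ⊥-elim (¬inc (inj₂ refl))
    apart high-end high-end ≢ _ _ = ⊥-elim (≢ refl)

  core-along : ∀ e ρ q → q ∈[ interval ρ ] → Core (owner e ρ) (along e q)
  core-along e ρ q q∈ = begin
    pot (owner e ρ) (along e q)     ≡⟨ pot-along (owner e ρ) e q (interval-bounded ρ q∈) ⟩
    capped (part (owner e ρ) e) q   ≡⟨ cong (λ J → capped J q) (part-owner e ρ) ⟩
    capped (just ρ) q               ≡⟨ capped-inside ρ q q∈ ⟩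
    0                               ∎
    where open ≡-Reasoning

  reachable-in-part : ∀ e ρ {i j} → i ∈[ interval ρ ] → j ∈[ interval ρ ] → i ≤ j →
                      Reachable Sub (Core (owner e ρ)) (along e i) (along e j)
  reachable-in-part e ρ (lo≤i , _) j∈@(_ , j≤hi) i≤j =
    path-reachable (along e) (≤″⇒≤‴ (≤⇒≤″ i≤j))
      (λ q _ q<j → along-adjacent e q (s≤s⁻¹ (≤-trans q<j (interval-bounded ρ j∈))))
      (λ q i≤q q≤j → core-along e ρ q (≤-trans lo≤i i≤q , ≤-trans q≤j j≤hi))

  hub : Member H → SubV H s
  hub (inj₁ v) = inj₁ v
  hub (inj₂ e) = along e r

  hub-core : ∀ m → Core m (hub m)
  hub-core (inj₁ v) with member-≟ {H} (inj₁ v) (inj₁ v)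
  ... | yes _ = refl
  ... | no v≢v = ⊥-elim (v≢v refl)
  hub-core (inj₂ e) = core-along e middle r (≤-refl , m≤n⇒m≤1+n (m≤m+n r r))

  Branch : Member H → VSet Sub
  Branch m = Component Sub (Core m) (hub m)

  branches-meet : ∀ v e → Incident H (inj₁ v) (inj₂ e) → ∃[ a ] (Branch (inj₁ v) a × Branch (inj₂ e) a)
  branches-meet v e (inj₁ refl) =
    along e r ,
    (core-along e low-end r r∈low , reachable-in-part e low-end (z≤n , z≤n) r∈low z≤n) ,
    (core-along e middle r r∈middle , reachable-refl (hub-core (inj₂ e)))
    where
    r∈low = z≤n , ≤-refl
    r∈middle = ≤-refl , m≤n⇒m≤1+n (m≤m+n r r)
  branches-meet v e (inj₂ refl) =
    along e (suc (r + r)) ,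
    (core-along e high-end _ 2r+1∈high ,
     subst (λ h → Reachable Sub (Core (owner e high-end)) h (along e (suc (r + r)))) (along-high e)
       (reachable-sym (reachable-in-part e high-end 2r+1∈high (s≤s r+r≤s , ≤-refl) (s≤s r+r≤s)))) ,
    (core-along e middle _ 2r+1∈middle ,
     reachable-in-part e middle (≤-refl , m≤n⇒m≤1+n (m≤m+n r r)) 2r+1∈middle (m≤n⇒m≤1+n (m≤m+n r r)))
    where
    2r+1∈high = ≤-refl , s≤s r+r≤s
    2r+1∈middle = m≤n⇒m≤1+n (m≤m+n r r) , ≤-refl

  fat : FatMinorModel r H Sub
  fat = record
    { M = Branch
    ; conn = λ m → component-connected (hub-core m)
    ; F1 = branches-meet
    ; F2 = λ m m′ m≢m′ ¬inc →
             lipschitz⇒distGE (pot-lipschitz m) (λ _ → proj₁) (λ a a∈ → pot-far m m′ m≢m′ ¬inc a (proj₁ a∈))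
    }

-- (F2) is vacuous for r = 0, so the members can be components of the whole graph.
zero-fat-minor : (H : FinGraph) → FatMinorModel 0 H (Subdivision H 0)
zero-fat-minor H = record
  { M = λ m → Component Sub (All Sub) (root m)
  ; conn = λ m → component-connected tt
  ; F1 = meet
  ; F2 = λ _ _ _ _ _ _ _ _ _ _ → z≤n
  }
  where
  Sub = Subdivision H 0

  root : Member H → SubV H 0
  root (inj₁ v) = inj₁ v
  root (inj₂ e) = inj₁ (low {H} e)

  meet : ∀ v e → Incident H (inj₁ v) (inj₂ e) →
         ∃[ a ] (Component Sub (All Sub) (root (inj₁ v)) a × Component Sub (All Sub) (root (inj₂ e)) a)
  meet v e (inj₁ refl) = inj₁ v , (tt , reachable-refl tt) , (tt , reachable-refl tt)
  meet v (_ , _ , _ , ij) (inj₂ refl) =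
    inj₁ v , (tt , reachable-refl tt) , (tt , reachable-step tt (refl , ij) (reachable-refl tt))

subdivision-fat-minor : ∀ r H → FatMinorModel r H (Subdivision H (3 * r))
subdivision-fat-minor zero H = zero-fat-minor H
subdivision-fat-minor (suc t) H = FatInSubdivision.fat H t

lemma17 : (r : ℕ) (H : FinGraph) (𝒢 : Graph → Set) →
    InducedClosed 𝒢 →
    (∀ G → 𝒢 G → ¬ IsFatMinor r H G) →
    ∀ G → 𝒢 G → ¬ IsInducedMinor (Subdivision H (3 * r)) G
lemma17 r H 𝒢 closed no-fat-minor G G∈𝒢 μ =
  no-fat-minor (CoveredGraph μ) (closed G G∈𝒢 (Covered μ)) (lift-fat μ (subdivision-fat-minor r H))
  where open Lifting
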